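{- If $k\geq 3$ and $Q_k$ is the $k$-dimensional hypercube, then $k+1 \leq B(Q_k) \leq \left\lfloor \frac{3k}{2} \right\rfloor$.
   Context: $Q_k$ has vertex set $\{0,1\}^k$, two vertices adjacent iff they differ in exactly one coordinate. Bodyguards and Presidents is a two-player game on a finite simple graph $G$. One player controls a set of tokens called bodyguards, the other a single token called the president. First all bodyguards are placed on vertices (several may share a vertex), then the president is placed. The players then alternate turns, bodyguards first; on a player's turn, each token they control either moves to an adjacent vertex or stays put. The president is surrounded if every vertex of the open neighbourhood of the president's vertex is occupied by a bodyguard. The bodyguards win if there is a finite time after which, at the end of every bodyguard turn, the president is surrounded; otherwise the president wins. The bodyguard number $B(G)$ is the minimum number of bodyguards that guarantees a win for the bodyguards on $G$. -}

module Defs where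

open import Data.Nat using (ℕ; zero; suc; _≤_; _+_)
open import Data.Bool using (Bool)
open import Data.Fin using (Fin)
open import Data.Vec using (Vec; lookup)
open import Data.List using (List; []; map; upTo)
open import Data.Product using (Σ; ∃; _×_; Σ-syntax; ∃-syntax)
open import Data.Sum using (_⊎_)
open import Relation.Binary.PropositionalEquality using (_≡_; _≢_)
open import Level using (0ℓ)

QV : ℕ → Set
QV k = Vec Bool k

QAdj : (k : ℕ) → QV k → QV k → Set
QAdj k u v = Σ[ i ∈ Fin k ] (lookup u i ≢ lookup v i × (∀ j → j ≢ i → lookup u j ≡ lookup v j))

module Game (V : Set) (Adj : V → V → Set) where

  Step : V → V → Set
  Step x y = x ≡ y ⊎ Adj x y

  -- placement of n bodyguards (several may share a vertex)
  Config : ℕ → Set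
  Config n = Fin n → V

  BStep : {n : ℕ} → Config n → Config n → Set
  BStep C D = ∀ i → Step (C i) (D i)

  Surrounded : {n : ℕ} → Config n → V → Set
  Surrounded {n} C v = ∀ w → Adj v w → ∃[ i ] (C i ≡ w)

  -- A bodyguard strategy maps the president's history (p₀ , … , p_t),
  -- in chronological order, to the bodyguards' configuration; the empty
  -- history gives the initial placement.
  BStrategy : ℕ → Set
  BStrategy n = List V → Config n

  history : (ℕ → V) → ℕ → List V
  history p t = map p (upTo (suc t))

  -- bodyguard configuration at time t (B 0 initial; B (suc t) after the
  -- bodyguards' (t+1)-st turn, having seen p₀ … p_t)
  play : {n : ℕ} → BStrategy n → (ℕ → V) → ℕ → Config n
  play σ p zero = σ []
  play σ p (suc t) = σ (history p t)

  -- president sequence: p 0 is the initial placement (chosen after the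
  -- bodyguards' placement), p (suc t) is the position after his (t+1)-st turn
  ValidPresident : (ℕ → V) → Set
  ValidPresident p = ∀ t → Step (p t) (p (suc t))

  Winning : {n : ℕ} → BStrategy n → Set
  Winning {n} σ = ∀ (p : ℕ → V) → ValidPresident p →
      (∀ t → BStep (play σ p t) (play σ p (suc t)))
    × (∃[ T ] (∀ t → T ≤ t → Surrounded (play σ p (suc t)) (p t)))

  BodyguardsWin : ℕ → Set
  BodyguardsWin n = ∃[ σ ] Winning {n} σ

  -- bounds on the bodyguard number B(G) = min { n | BodyguardsWin n }
  B≥ : ℕ → Set
  B≥ m = ∀ n → BodyguardsWin n → m ≤ n

  B≤ : ℕ → Set
  B≤ m = ∃[ n ] (n ≤ m × BodyguardsWin n)

{-# OPTIONS --safe #-}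
-- Lower bound: against at most k bodyguards the president starts antipodal to
-- one bodyguard and, whenever he can, moves one step further away from it.
-- That bodyguard then never ends its turn next to the president, so at most
-- k - 1 bodyguards are left for the k neighbours.
--
-- Upper bound: k + ⌊k/2⌋ bodyguards occupy the neighbours of the president one
-- direction i at a time. Bodyguards already placed copy the president's moves.
-- Of the others, one chases the neighbour in direction i watching coordinate
-- k - 1, and ⌊k/2⌋ chase it watching the pairs (r , r + ⌊k/2⌋). A chaser reaches
-- its target or strictly reduces its distance-like potential whenever the
-- president's move is one it watches, and never increases it otherwise; every
-- move (including staying) is watched by some chaser. So the number of
-- remaining directions, followed by the sum of the chasers' potentials,
-- decreases lexicographically every round until all k neighbours are occupied.
module Submission where

open import Defs
open import Data.Bool using (Bool; true; false; not; _xor_; if_then_else_)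
open import Data.Bool.Properties using (not-involutive; not-¬; ¬-not; xor-same; not-distribˡ-xor; not-distribʳ-xor)
  renaming (_≟_ to _≟ᵇ_)
open import Data.Empty using (⊥-elim)
open import Data.Fin using (Fin; zero; suc; toℕ; fromℕ; fromℕ<; inject≤; _≟_)
open import Data.Fin.Permutation using (Permutation′; _⟨$⟩ʳ_; _⟨$⟩ˡ_; _∘ₚ_; transpose; inverseʳ; inverseˡ)
import Data.Fin.Permutation as Permutation
import Data.Fin.Permutation.Components as PC
open import Data.Fin.Properties using (toℕ-injective; injective⇒≤; toℕ-fromℕ<; toℕ-fromℕ; toℕ-inject≤; toℕ<n; any?)
open import Data.List using (List; []; _∷_; _∷ʳ_; upTo)
import Data.List as List
open import Data.List.Properties using (upTo-∷ʳ; map-++; foldl-∷ʳ)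
open import Data.Maybe using (Maybe; just; nothing)
open import Data.Nat using (ℕ; zero; suc; _+_; _*_; _∸_; _≤_; _<_; z≤n; s≤s; _<?_)
open import Data.Nat.DivMod using (_/_; _%_; m/n*n≤m; m≡m%n+[m/n]*n; m%n<n; m≥n⇒m/n>0; +-distrib-/-∣ˡ; m*n/n≡m)
open import Data.Nat.Divisibility using (divides)
open import Data.Nat.Properties
  using ( ≤-refl; ≤-trans; ≤-reflexive; ≤-antisym; <-irrefl; <-irrelevant; <⇒≢; <⇒≱; ≮⇒≥; ≤⇒≯; ≤∧≢⇒<
        ; <-≤-trans; n≤1+n; n<1+n; m≤n⇒m≤1+n; m<1+n⇒m≤n; m≤m+n; m≤n+m; m<m+n
        ; +-comm; +-identityʳ; +-suc; *-comm; *-suc; m+n∸m≡n; m∸n+n≡m; +-∸-assoc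
        ; +-mono-≤; +-monoˡ-≤; +-monoʳ-≤; +-monoʳ-<; +-mono-<-≤; +-mono-≤-<; +-cancelʳ-<; *-monoʳ-≤
        ; +-0-monoid; module ≤-Reasoning )
  renaming (_≟_ to _ℕ≟_)
open import Algebra.Properties.Monoid.Sum +-0-monoid using (sum)
open import Data.Product using (∃; ∃-syntax; _×_; _,_; proj₁; proj₂)
open import Data.Sum using (_⊎_; inj₁; inj₂)
open import Data.Vec using (Vec; []; _∷_; lookup; replicate; zipWith; countᵇ; _[_]≔_)
import Data.Vec as Vec
open import Data.Vec.Properties using (count≤n; lookup-replicate; lookup∘update; lookup∘update′; ≡-dec)
open import Data.Vec.Relation.Binary.Pointwise.Extensional using (ext; Pointwise-≡⇒≡)
open import Function using (id; _∘_; flip)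
open import Relation.Binary.PropositionalEquality
open import Relation.Nullary using (¬_; yes; no; contradiction)
open import Relation.Nullary.Decidable using (_×-dec_)
open import Relation.Unary using (Decidable)

private variable
  n : ℕ

vec-ext : {u v : Vec Bool n} → (∀ i → lookup u i ≡ lookup v i) → u ≡ v
vec-ext u≗v = Pointwise-≡⇒≡ (ext u≗v)

-- Indexed by ℕ so that the strategy's slot numbers can be used as coordinates.
flipAt : ℕ → Vec Bool n → Vec Bool n
flipAt _       []      = []
flipAt zero    (b ∷ v) = not b ∷ v
flipAt (suc s) (b ∷ v) = b ∷ flipAt s v

lookup-flipAt : ∀ (v : Vec Bool n) i → lookup (flipAt (toℕ i) v) i ≡ not (lookup v i)
lookup-flipAt (b ∷ v) zero    = refl
lookup-flipAt (b ∷ v) (suc i) = lookup-flipAt v i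

lookup-flipAt-≢ : ∀ (v : Vec Bool n) {s} i → toℕ i ≢ s → lookup (flipAt s v) i ≡ lookup v i
lookup-flipAt-≢ (b ∷ v) {zero}  zero    i≢s = ⊥-elim (i≢s refl)
lookup-flipAt-≢ (b ∷ v) {suc s} zero    i≢s = refl
lookup-flipAt-≢ (b ∷ v) {zero}  (suc i) i≢s = refl
lookup-flipAt-≢ (b ∷ v) {suc s} (suc i) i≢s = lookup-flipAt-≢ v i (i≢s ∘ cong suc)

flipAt-involutive : ∀ s (v : Vec Bool n) → flipAt s (flipAt s v) ≡ v
flipAt-involutive _       []      = refl
flipAt-involutive zero    (b ∷ v) = cong (_∷ v) (not-involutive b)
flipAt-involutive (suc s) (b ∷ v) = cong (b ∷_) (flipAt-involutive s v)

flipAt-comm : ∀ s t (v : Vec Bool n) → flipAt s (flipAt t v) ≡ flipAt t (flipAt s v)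
flipAt-comm _       _       []      = refl
flipAt-comm zero    zero    (b ∷ v) = refl
flipAt-comm zero    (suc t) (b ∷ v) = refl
flipAt-comm (suc s) zero    (b ∷ v) = refl
flipAt-comm (suc s) (suc t) (b ∷ v) = cong (b ∷_) (flipAt-comm s t v)

flipAt-injective : ∀ (v : Vec Bool n) (i j : Fin n) → flipAt (toℕ i) v ≡ flipAt (toℕ j) v → i ≡ j
flipAt-injective (b ∷ v) zero    zero    _  = refl
flipAt-injective (b ∷ v) zero    (suc j) eq = ⊥-elim (not-¬ refl (sym (cong Vec.head eq)))
flipAt-injective (b ∷ v) (suc i) zero    eq = ⊥-elim (not-¬ refl (cong Vec.head eq))
flipAt-injective (b ∷ v) (suc i) (suc j) eq = cong suc (flipAt-injective v i j (cong Vec.tail eq))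

infixl 6 _⊕_
_⊕_ : Vec Bool n → Vec Bool n → Vec Bool n
_⊕_ = zipWith _xor_

flipAt-⊕ˡ : ∀ s (u v : Vec Bool n) → flipAt s (u ⊕ v) ≡ flipAt s u ⊕ v
flipAt-⊕ˡ _       []      []      = refl
flipAt-⊕ˡ zero    (a ∷ u) (b ∷ v) = cong (_∷ u ⊕ v) (not-distribˡ-xor a b)
flipAt-⊕ˡ (suc s) (a ∷ u) (b ∷ v) = cong ((a xor b) ∷_) (flipAt-⊕ˡ s u v)

flipAt-⊕ʳ : ∀ s (u v : Vec Bool n) → flipAt s (u ⊕ v) ≡ u ⊕ flipAt s v
flipAt-⊕ʳ _       []      []      = refl
flipAt-⊕ʳ zero    (a ∷ u) (b ∷ v) = cong (_∷ u ⊕ v) (not-distribʳ-xor a b)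
flipAt-⊕ʳ (suc s) (a ∷ u) (b ∷ v) = cong ((a xor b) ∷_) (flipAt-⊕ʳ s u v)

⊕-self : ∀ (u : Vec Bool n) → u ⊕ u ≡ replicate n false
⊕-self []      = refl
⊕-self (a ∷ u) = cong₂ _∷_ (xor-same a) (⊕-self u)

⊕-not : ∀ (u : Vec Bool n) → u ⊕ Vec.map not u ≡ replicate n true
⊕-not []          = refl
⊕-not (false ∷ u) = cong (true ∷_) (⊕-not u)
⊕-not (true ∷ u)  = cong (true ∷_) (⊕-not u)

⊕≡false⇒≡ : ∀ (u v : Vec Bool n) → u ⊕ v ≡ replicate n false → u ≡ v
⊕≡false⇒≡ []          []          _  = refl
⊕≡false⇒≡ (false ∷ u) (false ∷ v) eq = cong (false ∷_) (⊕≡false⇒≡ u v (cong Vec.tail eq))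
⊕≡false⇒≡ (true ∷ u)  (true ∷ v)  eq = cong (true ∷_) (⊕≡false⇒≡ u v (cong Vec.tail eq))
⊕≡false⇒≡ (false ∷ u) (true ∷ v)  ()
⊕≡false⇒≡ (true ∷ u)  (false ∷ v) ()

weight : Vec Bool n → ℕ
weight = countᵇ id

weight≤n : ∀ (v : Vec Bool n) → weight v ≤ n
weight≤n = count≤n _

weight-replicate : ∀ n b → weight (replicate n b) ≡ (if b then n else 0)
weight-replicate zero    false = refl
weight-replicate zero    true  = refl
weight-replicate (suc n) false = weight-replicate n false
weight-replicate (suc n) true  = cong suc (weight-replicate n true)

weight-flipAt-false : ∀ (v : Vec Bool n) i → lookup v i ≡ false →
                      weight (flipAt (toℕ i) v) ≡ suc (weight v)
weight-flipAt-false (false ∷ v) zero    _  = refl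
weight-flipAt-false (false ∷ v) (suc i) vi = weight-flipAt-false v i vi
weight-flipAt-false (true ∷ v)  (suc i) vi = cong suc (weight-flipAt-false v i vi)

weight-flipAt-true : ∀ (v : Vec Bool n) i → lookup v i ≡ true →
                     weight v ≡ suc (weight (flipAt (toℕ i) v))
weight-flipAt-true v i vi = begin
  weight v                                    ≡⟨ cong weight (flipAt-involutive (toℕ i) v) ⟨
  weight (flipAt (toℕ i) (flipAt (toℕ i) v))  ≡⟨ weight-flipAt-false (flipAt (toℕ i) v) i (trans (lookup-flipAt v i) (cong not vi)) ⟩
  suc (weight (flipAt (toℕ i) v))             ∎
  where open ≡-Reasoning

weight≤1+weight-flipAt : ∀ s (v : Vec Bool n) → weight v ≤ suc (weight (flipAt s v))
weight≤1+weight-flipAt _       []          = z≤n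
weight≤1+weight-flipAt zero    (false ∷ v) = m≤n⇒m≤1+n (n≤1+n _)
weight≤1+weight-flipAt zero    (true ∷ v)  = ≤-refl
weight≤1+weight-flipAt (suc s) (false ∷ v) = weight≤1+weight-flipAt s v
weight≤1+weight-flipAt (suc s) (true ∷ v)  = s≤s (weight≤1+weight-flipAt s v)

find : ∀ b (v : Vec Bool n) → (∃[ i ] lookup v i ≡ b) ⊎ v ≡ replicate n (not b)
find b []      = inj₂ refl
find b (a ∷ v) with a ≟ᵇ b | find b v
... | yes a≡b | _              = inj₁ (zero , a≡b)
... | no _    | inj₁ (i , vi≡b) = inj₁ (suc i , vi≡b)
... | no a≢b  | inj₂ v≡¬b      = inj₂ (cong₂ _∷_ (¬-not a≢b) v≡¬b)

weight≡0⇒≡replicate : ∀ (v : Vec Bool n) → weight v ≡ 0 → v ≡ replicate n false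
weight≡0⇒≡replicate []          _  = refl
weight≡0⇒≡replicate (false ∷ v) eq = cong (false ∷_) (weight≡0⇒≡replicate v eq)

distance : Vec Bool n → Vec Bool n → ℕ
distance u v = weight (u ⊕ v)

module _ {n : ℕ} where
  open Game (QV n) (QAdj n) using (Step)

  QAdj-flipAt : ∀ (v : QV n) i → QAdj n v (flipAt (toℕ i) v)
  QAdj-flipAt v i =
    i , (λ eq → not-¬ refl (trans eq (lookup-flipAt v i))) ,
    (λ j j≢i → sym (lookup-flipAt-≢ v j (j≢i ∘ toℕ-injective)))

  QAdj⇒flipAt : ∀ {u v : QV n} (u~v : QAdj n u v) → v ≡ flipAt (toℕ (proj₁ u~v)) u
  QAdj⇒flipAt {u} {v} (i , ui≢vi , rest) = vec-ext coordinate
    where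
    coordinate : ∀ j → lookup v j ≡ lookup (flipAt (toℕ i) u) j
    coordinate j with j ≟ i
    ... | yes refl = trans (¬-not (ui≢vi ∘ sym)) (sym (lookup-flipAt u i))
    ... | no j≢i   = trans (sym (rest j j≢i)) (sym (lookup-flipAt-≢ u j (j≢i ∘ toℕ-injective)))

  move : QV n → Maybe (Fin n) → QV n
  move v nothing  = v
  move v (just i) = flipAt (toℕ i) v

  move-step : ∀ v m → Step v (move v m)
  move-step v nothing  = inj₁ refl
  move-step v (just i) = inj₂ (QAdj-flipAt v i)

  step⇒move : ∀ {u v} → Step u v → ∃[ m ] v ≡ move u m
  step⇒move (inj₁ refl) = nothing , refl
  step⇒move (inj₂ u~v)  = just (proj₁ u~v) , QAdj⇒flipAt u~v

  flipAt-move : ∀ s v m → flipAt s (move v m) ≡ move (flipAt s v) m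
  flipAt-move s v nothing  = refl
  flipAt-move s v (just i) = flipAt-comm s (toℕ i) v

  move-⊕ˡ : ∀ (u v : Vec Bool n) m → move u m ⊕ v ≡ move (u ⊕ v) m
  move-⊕ˡ u v nothing  = refl
  move-⊕ˡ u v (just i) = sym (flipAt-⊕ˡ (toℕ i) u v)

  move-⊕ʳ : ∀ (u v : Vec Bool n) m → u ⊕ move v m ≡ move (u ⊕ v) m
  move-⊕ʳ u v nothing  = refl
  move-⊕ʳ u v (just i) = sym (flipAt-⊕ʳ (toℕ i) u v)

  flipAt-step : ∀ s {p p'} → Step p p' → Step (flipAt s p) (flipAt s p')
  flipAt-step s {p} p~p' with step⇒move p~p'
  ... | μ , refl = subst (Step (flipAt s p)) (sym (flipAt-move s p μ)) (move-step (flipAt s p) μ)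

module GameProperties (V : Set) (Adj : V → V → Set) where
  open Game V Adj

  history-suc : ∀ (p : ℕ → V) t → history p (suc t) ≡ history p t ∷ʳ p (suc t)
  history-suc p t = begin
    List.map p (upTo (suc (suc t)))     ≡⟨ cong (List.map p) (upTo-∷ʳ (suc t)) ⟨
    List.map p (upTo (suc t) ∷ʳ suc t)  ≡⟨ map-++ p (upTo (suc t)) (suc t ∷ []) ⟩
    history p t ∷ʳ p (suc t)            ∎
    where open ≡-Reasoning

  Surrounded-tail : ∀ {m} {C : Config (suc m)} {v} → Surrounded C v →
                    (∀ w → Adj v w → C zero ≢ w) → Surrounded (C ∘ suc) v
  Surrounded-tail surr notAt w v~w with surr w v~w
  ... | zero  , C₀≡w = ⊥-elim (notAt w v~w C₀≡w)
  ... | suc i , Cᵢ≡w = i , Cᵢ≡w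

  reactivePlay : (List V → V → V) → V → ℕ → List V × V
  reactivePlay next p₀ zero    = p₀ ∷ [] , p₀
  reactivePlay next p₀ (suc t) =
    let (H , p) = reactivePlay next p₀ t in H ∷ʳ next H p , next H p

  reactivePresident : (List V → V → V) → V → ℕ → V
  reactivePresident next p₀ t = proj₂ (reactivePlay next p₀ t)

  history-reactivePresident : ∀ next p₀ t →
    history (reactivePresident next p₀) t ≡ proj₁ (reactivePlay next p₀ t)
  history-reactivePresident next p₀ zero    = refl
  history-reactivePresident next p₀ (suc t) =
    trans (history-suc p t) (cong (_∷ʳ p (suc t)) (history-reactivePresident next p₀ t))
    where p = reactivePresident next p₀

  reactivePresident-valid : ∀ {next} p₀ → (∀ H p → Step p (next H p)) →
                            ValidPresident (reactivePresident next p₀)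
  reactivePresident-valid {next} p₀ step t = step _ (reactivePresident next p₀ t)

  reactivePresident-suc : ∀ next p₀ t → let p = reactivePresident next p₀ in
    p (suc t) ≡ next (history p t) (p t)
  reactivePresident-suc next p₀ t =
    cong (λ H → next H (reactivePresident next p₀ t)) (sym (history-reactivePresident next p₀ t))

-- Lower bound

module _ {k : ℕ} where
  open Game (QV k) (QAdj k)
  open GameProperties (QV k) (QAdj k)

  distance-neighbour : ∀ {v w} → QAdj k v w → distance w v ≡ 1
  distance-neighbour {v} {w} v~w@(i , _) = begin
    weight (w ⊕ v)                                   ≡⟨ cong (λ u → weight (u ⊕ v)) (QAdj⇒flipAt {u = v} {v = w} v~w) ⟩
    weight (flipAt (toℕ i) v ⊕ v)                    ≡⟨ cong weight (flipAt-⊕ˡ (toℕ i) v v) ⟨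
    weight (flipAt (toℕ i) (v ⊕ v))                  ≡⟨ cong (weight ∘ flipAt (toℕ i)) (⊕-self v) ⟩
    weight (flipAt (toℕ i) (replicate k false))      ≡⟨ weight-flipAt-false (replicate k false) i (lookup-replicate i false) ⟩
    suc (weight (replicate k false))                 ≡⟨ cong suc (weight-replicate k false) ⟩
    1                                                ∎
    where open ≡-Reasoning

  distance-step : ∀ {c c'} → Step c c' → ∀ v → distance c v ≤ suc (distance c' v)
  distance-step {c} c↝c' v with step⇒move c↝c'
  ... | nothing , refl = n≤1+n _
  ... | just i  , refl = subst (λ u → weight (c ⊕ v) ≤ suc (weight u)) (flipAt-⊕ˡ (toℕ i) c v)
                               (weight≤1+weight-flipAt (toℕ i) (c ⊕ v))

  surrounded⇒k≤n : ∀ {n} {C : Config n} {v} → Surrounded C v → k ≤ n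
  surrounded⇒k≤n {C = C} {v} surr = injective⇒≤ guardOf-injective
    where
    guardOf : Fin k → Fin _
    guardOf i = proj₁ (surr _ (QAdj-flipAt v i))
    guardOf-injective : ∀ {i j} → guardOf i ≡ guardOf j → i ≡ j
    guardOf-injective {i} {j} eq = flipAt-injective v i j (begin
      flipAt (toℕ i) v  ≡⟨ proj₂ (surr _ (QAdj-flipAt v i)) ⟨
      C (guardOf i)     ≡⟨ cong C eq ⟩
      C (guardOf j)     ≡⟨ proj₂ (surr _ (QAdj-flipAt v j)) ⟩
      flipAt (toℕ j) v  ∎)
      where open ≡-Reasoning

  awayFrom : QV k → QV k → Maybe (Fin k)
  awayFrom c p with find false (c ⊕ p)
  ... | inj₁ (i , _) = just i
  ... | inj₂ _       = nothing

  distance-awayFrom : ∀ c p → let p' = move p (awayFrom c p) in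
                      distance c p' ≡ suc (distance c p) ⊎ distance c p' ≡ k
  distance-awayFrom c p with find false (c ⊕ p)
  ... | inj₁ (i , agree) = inj₁ (begin
    weight (c ⊕ flipAt (toℕ i) p)  ≡⟨ cong weight (flipAt-⊕ʳ (toℕ i) c p) ⟨
    weight (flipAt (toℕ i) (c ⊕ p))  ≡⟨ weight-flipAt-false (c ⊕ p) i agree ⟩
    suc (weight (c ⊕ p))             ∎)
    where open ≡-Reasoning
  ... | inj₂ differ = inj₂ (trans (cong weight differ) (weight-replicate k true))

module _ {k : ℕ} (3≤k : 3 ≤ k) where
  open Game (QV k) (QAdj k)
  open GameProperties (QV k) (QAdj k)

  escapeFrom : QV k → QV k → QV k
  escapeFrom c p = move p (awayFrom c p)

  3≤distance-escapeFrom : ∀ c p → 2 ≤ distance c p → 3 ≤ distance c (escapeFrom c p)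
  3≤distance-escapeFrom c p 2≤d with distance-awayFrom c p
  ... | inj₁ eq = subst (3 ≤_) (sym eq) (s≤s 2≤d)
  ... | inj₂ eq = subst (3 ≤_) (sym eq) 3≤k

  runAwayFromGuard₀ : ∀ {m} → BStrategy (suc m) → ℕ → QV k
  runAwayFromGuard₀ σ = reactivePresident (λ H → escapeFrom (σ H zero)) (Vec.map not (σ [] zero))

  module _ {m} (σ : BStrategy (suc m)) where
    private
      p = runAwayFromGuard₀ σ
      guard₀ : ℕ → QV k
      guard₀ t = play σ p t zero

    runAwayFromGuard₀-valid : ValidPresident p
    runAwayFromGuard₀-valid =
      reactivePresident-valid (Vec.map not (σ [] zero)) (λ H p → move-step p (awayFrom (σ H zero) p))

    module _ (legal : ∀ t → BStep (play σ p t) (play σ p (suc t))) where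
      3≤distance : ∀ t → 3 ≤ distance (guard₀ t) (p t)
      2≤distance : ∀ t → 2 ≤ distance (guard₀ (suc t)) (p t)

      3≤distance zero =
        subst (3 ≤_) (sym (trans (cong weight (⊕-not (σ [] zero))) (weight-replicate k true))) 3≤k
      3≤distance (suc t) =
        subst (λ q → 3 ≤ distance (guard₀ (suc t)) q)
              (sym (reactivePresident-suc (λ H → escapeFrom (σ H zero)) (Vec.map not (σ [] zero)) t))
              (3≤distance-escapeFrom (guard₀ (suc t)) (p t) (2≤distance t))
      2≤distance t = m<1+n⇒m≤n (≤-trans (3≤distance t) (distance-step (legal t zero) (p t)))

  few-guards-lose : ∀ {n} → n ≤ k → (σ : BStrategy n) → ¬ Winning σ
  few-guards-lose {zero} _ σ win with win (λ _ → replicate k false) (λ _ → inj₁ refl)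
  ... | _ , T , surr = contradiction (≤-trans 3≤k (surrounded⇒k≤n {v = replicate k false} (surr T ≤-refl))) λ ()
  few-guards-lose {suc m} m<k σ win with win (runAwayFromGuard₀ σ) (runAwayFromGuard₀-valid σ)
  ... | legal , T , surr = <⇒≱ m<k (surrounded⇒k≤n {v = p T} (Surrounded-tail {v = p T} (surr T ≤-refl) guard₀-absent))
    where
    p = runAwayFromGuard₀ σ
    guard₀-absent : ∀ w → QAdj k (p T) w → play σ p (suc T) zero ≢ w
    guard₀-absent w adj refl with subst (2 ≤_) (distance-neighbour {v = p T} {w = w} adj) (2≤distance σ legal T)
    ... | s≤s ()

lower-bound : ∀ k → 3 ≤ k → Game.B≥ (QV k) (QAdj k) (k + 1)
lower-bound k 3≤k n (σ , win) =
  ≮⇒≥ (λ n<k+1 → few-guards-lose 3≤k (m<1+n⇒m≤n (subst (n <_) (+-comm k 1) n<k+1)) σ win)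

-- One pursuer against a moving target

data Watch : Set where
  pairFlips stillOrX : Watch

-- The offset between a pursuer watching coordinates x and y and its target:
-- the number of other coordinates in which they differ, and the offset at x and y.
record View : Set where
  constructor ⟨_,_,_⟩
  field
    rest    : ℕ
    atX atY : Bool

caught : View
caught = ⟨ 0 , false , false ⟩

⟨⟩-cong : ∀ {r r' a a' b b'} → r ≡ r' → a ≡ a' → b ≡ b' → ⟨ r , a , b ⟩ ≡ ⟨ r' , a' , b' ⟩
⟨⟩-cong refl refl refl = refl

pairPotential : Watch → Bool → Bool → ℕ
pairPotential pairFlips a b = if a xor b then 1 else 0
pairPotential stillOrX  _ b = if b then 1 else 0

-- Each differing coordinate outside the pair costs more than the whole pair
-- part (pairPotential≤1), so repairing one always pays for any change of the pair.
potential : Watch → View → ℕ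
potential w ⟨ zero  , a , b ⟩ = pairPotential w a b
potential w ⟨ suc r , a , b ⟩ = 2 + potential w ⟨ r , a , b ⟩

data PairMove : Set where
  keep moveX moveY : PairMove

pairMove : Watch → Bool → Bool → PairMove
pairMove _         false false = keep
pairMove _         true  false = moveX
pairMove _         false true  = moveY
pairMove pairFlips true  true  = keep
pairMove stillOrX  true  true  = moveY

applyX applyY : PairMove → Bool → Bool
applyX moveX = not
applyX _     = id
applyY moveY = not
applyY _     = id

respond : Watch → View → View
respond w ⟨ suc r , a , b ⟩ = ⟨ r , a , b ⟩
respond w ⟨ zero  , a , b ⟩ = ⟨ zero , applyX (pairMove w a b) a , applyY (pairMove w a b) b ⟩

data MoveKind : Set where
  still alongX alongY elsewhere : MoveKind

data _⟶[_]_ : View → MoveKind → View → Set where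
  stay  : ∀ {v} → v ⟶[ still ] v
  flipX : ∀ {r a b} → ⟨ r , a , b ⟩ ⟶[ alongX ] ⟨ r , not a , b ⟩
  flipY : ∀ {r a b} → ⟨ r , a , b ⟩ ⟶[ alongY ] ⟨ r , a , not b ⟩
  up    : ∀ {r a b} → ⟨ r , a , b ⟩ ⟶[ elsewhere ] ⟨ suc r , a , b ⟩
  down  : ∀ {r a b} → ⟨ suc r , a , b ⟩ ⟶[ elsewhere ] ⟨ r , a , b ⟩

data Watches : Watch → MoveKind → Set where
  pair-x      : Watches pairFlips alongX
  pair-y      : Watches pairFlips alongY
  still-still : Watches stillOrX still
  still-x     : Watches stillOrX alongX

pairPotential≤1 : ∀ w a b → pairPotential w a b ≤ 1
pairPotential≤1 pairFlips false false = z≤n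
pairPotential≤1 pairFlips false true  = s≤s z≤n
pairPotential≤1 pairFlips true  false = s≤s z≤n
pairPotential≤1 pairFlips true  true  = z≤n
pairPotential≤1 stillOrX  _     false = z≤n
pairPotential≤1 stillOrX  _     true  = s≤s z≤n

potential-respond-zero : ∀ w a b → potential w (respond w ⟨ zero , a , b ⟩) ≡ 0
potential-respond-zero pairFlips false false = refl
potential-respond-zero pairFlips false true  = refl
potential-respond-zero pairFlips true  false = refl
potential-respond-zero pairFlips true  true  = refl
potential-respond-zero stillOrX  false false = refl
potential-respond-zero stillOrX  false true  = refl
potential-respond-zero stillOrX  true  false = refl
potential-respond-zero stillOrX  true  true  = refl

potential-pair : ∀ w r a b a' b' → potential w ⟨ r , a' , b' ⟩ ≤ suc (potential w ⟨ r , a , b ⟩)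
potential-pair w zero    a b a' b' = ≤-trans (pairPotential≤1 w a' b') (s≤s z≤n)
potential-pair w (suc r) a b a' b' = s≤s (s≤s (potential-pair w r a b a' b'))

potential≤ : ∀ w v → potential w v ≤ 2 * View.rest v + 1
potential≤ w ⟨ zero  , a , b ⟩ = pairPotential≤1 w a b
potential≤ w ⟨ suc r , a , b ⟩ =
  subst (λ m → 2 + potential w ⟨ r , a , b ⟩ ≤ m + 1) (sym (*-suc 2 r)) (s≤s (s≤s (potential≤ w ⟨ r , a , b ⟩)))

respond-mono : ∀ {w κ v v'} → v ⟶[ κ ] v' → potential w (respond w v') ≤ potential w v
respond-mono {w} (stay {⟨ zero , a , b ⟩})  = ≤-trans (≤-reflexive (potential-respond-zero w a b)) z≤n
respond-mono     (stay {⟨ suc r , a , b ⟩}) = m≤n+m _ 2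
respond-mono {w} (flipX {zero} {a} {b})     = ≤-trans (≤-reflexive (potential-respond-zero w (not a) b)) z≤n
respond-mono {w} (flipX {suc r} {a} {b})    = m≤n⇒m≤1+n (potential-pair w r a b (not a) b)
respond-mono {w} (flipY {zero} {a} {b})     = ≤-trans (≤-reflexive (potential-respond-zero w a (not b))) z≤n
respond-mono {w} (flipY {suc r} {a} {b})    = m≤n⇒m≤1+n (potential-pair w r a b a (not b))
respond-mono     up                         = ≤-refl
respond-mono {w} (down {zero} {a} {b})      = ≤-trans (≤-reflexive (potential-respond-zero w a b)) z≤n
respond-mono     (down {suc r})             = m≤n+m _ 4

respond-progress : ∀ {w κ v v'} → Watches w κ → v ⟶[ κ ] v' →
                   respond w v' ≡ caught ⊎ potential w (respond w v') < potential w v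
respond-progress _ (stay {⟨ suc r , a , b ⟩})     = inj₂ (s≤s (n≤1+n _))
respond-progress {w} _ (flipX {suc r} {a} {b})    = inj₂ (s≤s (potential-pair w r a b (not a) b))
respond-progress {w} _ (flipY {suc r} {a} {b})    = inj₂ (s≤s (potential-pair w r a b a (not b)))
respond-progress pair-x (flipX {zero} {false} {false}) = inj₁ refl
respond-progress pair-x (flipX {zero} {false} {true})  = inj₂ (s≤s z≤n)
respond-progress pair-x (flipX {zero} {true}  {false}) = inj₁ refl
respond-progress pair-x (flipX {zero} {true}  {true})  = inj₁ refl
respond-progress pair-y (flipY {zero} {false} {false}) = inj₁ refl
respond-progress pair-y (flipY {zero} {false} {true})  = inj₁ refl
respond-progress pair-y (flipY {zero} {true}  {false}) = inj₂ (s≤s z≤n)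
respond-progress pair-y (flipY {zero} {true}  {true})  = inj₁ refl
respond-progress still-still (stay {⟨ zero , false , false ⟩}) = inj₁ refl
respond-progress still-still (stay {⟨ zero , false , true ⟩})  = inj₁ refl
respond-progress still-still (stay {⟨ zero , true , false ⟩})  = inj₁ refl
respond-progress still-still (stay {⟨ zero , true , true ⟩})   = inj₂ (s≤s z≤n)
respond-progress still-x (flipX {zero} {false} {false}) = inj₁ refl
respond-progress still-x (flipX {zero} {false} {true})  = inj₂ (s≤s z≤n)
respond-progress still-x (flipX {zero} {true}  {false}) = inj₁ refl
respond-progress still-x (flipX {zero} {true}  {true})  = inj₁ refl

record Pursuer (k : ℕ) : Set where
  field
    x y   : Fin k
    x≢y   : x ≢ y
    watch : Watch

module Pursuit {k} (c : Pursuer k) where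
  open Pursuer c

  outside : QV k → QV k
  outside o = (o [ x ]≔ false) [ y ]≔ false

  lookup-outside-x : ∀ o → lookup (outside o) x ≡ false
  lookup-outside-x o = trans (lookup∘update′ x≢y (o [ x ]≔ false) false) (lookup∘update x o false)

  lookup-outside-y : ∀ o → lookup (outside o) y ≡ false
  lookup-outside-y o = lookup∘update y (o [ x ]≔ false) false

  lookup-outside : ∀ o {j} → j ≢ x → j ≢ y → lookup (outside o) j ≡ lookup o j
  lookup-outside o j≢x j≢y =
    trans (lookup∘update′ j≢y (o [ x ]≔ false) false) (lookup∘update′ j≢x o false)

  outside-cong : ∀ o o' → (∀ j → j ≢ x → j ≢ y → lookup o j ≡ lookup o' j) → outside o ≡ outside o'
  outside-cong o o' agree = vec-ext coordinate
    where
    coordinate : ∀ j → lookup (outside o) j ≡ lookup (outside o') j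
    coordinate j with j ≟ x | j ≟ y
    ... | yes refl | _        = trans (lookup-outside-x o) (sym (lookup-outside-x o'))
    ... | no _     | yes refl = trans (lookup-outside-y o) (sym (lookup-outside-y o'))
    ... | no j≢x   | no j≢y   =
      trans (lookup-outside o j≢x j≢y) (trans (agree j j≢x j≢y) (sym (lookup-outside o' j≢x j≢y)))

  outside-flipAt : ∀ o {j} → j ≢ x → j ≢ y → outside (flipAt (toℕ j) o) ≡ flipAt (toℕ j) (outside o)
  outside-flipAt o {j} j≢x j≢y = vec-ext coordinate
    where
    coordinate : ∀ i → lookup (outside (flipAt (toℕ j) o)) i ≡ lookup (flipAt (toℕ j) (outside o)) i
    coordinate i with i ≟ x | i ≟ y | i ≟ j
    ... | yes refl | _        | _ = trans (lookup-outside-x (flipAt (toℕ j) o))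
      (sym (trans (lookup-flipAt-≢ (outside o) x (j≢x ∘ sym ∘ toℕ-injective)) (lookup-outside-x o)))
    ... | no _     | yes refl | _ = trans (lookup-outside-y (flipAt (toℕ j) o))
      (sym (trans (lookup-flipAt-≢ (outside o) y (j≢y ∘ sym ∘ toℕ-injective)) (lookup-outside-y o)))
    ... | no i≢x   | no i≢y   | yes refl = trans (lookup-outside (flipAt (toℕ i) o) i≢x i≢y)
      (trans (lookup-flipAt o i) (sym (trans (lookup-flipAt (outside o) i) (cong not (lookup-outside o i≢x i≢y)))))
    ... | no i≢x   | no i≢y   | no i≢j = begin
      lookup (outside (flipAt (toℕ j) o)) i  ≡⟨ lookup-outside (flipAt (toℕ j) o) i≢x i≢y ⟩
      lookup (flipAt (toℕ j) o) i            ≡⟨ lookup-flipAt-≢ o i (i≢j ∘ toℕ-injective) ⟩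
      lookup o i                             ≡⟨ lookup-outside o i≢x i≢y ⟨
      lookup (outside o) i                   ≡⟨ lookup-flipAt-≢ (outside o) i (i≢j ∘ toℕ-injective) ⟨
      lookup (flipAt (toℕ j) (outside o)) i  ∎
      where open ≡-Reasoning

  view : QV k → View
  view o = ⟨ weight (outside o) , lookup o x , lookup o y ⟩

  kindOf : Maybe (Fin k) → MoveKind
  kindOf nothing = still
  kindOf (just j) with j ≟ x | j ≟ y
  ... | yes _ | _     = alongX
  ... | no _  | yes _ = alongY
  ... | no _  | no _  = elsewhere

  kindOf-x : ∀ {j} → j ≡ x → kindOf (just j) ≡ alongX
  kindOf-x refl with x ≟ x
  ... | yes _   = refl
  ... | no x≢x  = contradiction refl x≢x

  kindOf-y : ∀ {j} → j ≡ y → kindOf (just j) ≡ alongY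
  kindOf-y refl with y ≟ x | y ≟ y
  ... | yes y≡x | _       = contradiction (sym y≡x) x≢y
  ... | no _    | yes _   = refl
  ... | no _    | no y≢y  = contradiction refl y≢y

  pairStep : PairMove → Maybe (Fin k)
  pairStep keep  = nothing
  pairStep moveX = just x
  pairStep moveY = just y

  rule : QV k → Maybe (Fin k)
  rule o with find true (outside o)
  ... | inj₁ (j , _) = just j
  ... | inj₂ _       = pairStep (pairMove watch (lookup o x) (lookup o y))

  toℕx≢toℕy : toℕ x ≢ toℕ y
  toℕx≢toℕy = x≢y ∘ toℕ-injective

  view-flipAt-x : ∀ o → view (flipAt (toℕ x) o) ≡ ⟨ weight (outside o) , not (lookup o x) , lookup o y ⟩
  view-flipAt-x o = ⟨⟩-cong
    (cong weight (outside-cong (flipAt (toℕ x) o) o λ j j≢x _ → lookup-flipAt-≢ o j (j≢x ∘ toℕ-injective)))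
    (lookup-flipAt o x)
    (lookup-flipAt-≢ o y (toℕx≢toℕy ∘ sym))

  view-flipAt-y : ∀ o → view (flipAt (toℕ y) o) ≡ ⟨ weight (outside o) , lookup o x , not (lookup o y) ⟩
  view-flipAt-y o = ⟨⟩-cong
    (cong weight (outside-cong (flipAt (toℕ y) o) o λ j _ j≢y → lookup-flipAt-≢ o j (j≢y ∘ toℕ-injective)))
    (lookup-flipAt-≢ o x toℕx≢toℕy)
    (lookup-flipAt o y)

  view-flipAt-outside : ∀ o {j} → j ≢ x → j ≢ y →
    view (flipAt (toℕ j) o) ≡ ⟨ weight (flipAt (toℕ j) (outside o)) , lookup o x , lookup o y ⟩
  view-flipAt-outside o j≢x j≢y = ⟨⟩-cong
    (cong weight (outside-flipAt o j≢x j≢y))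
    (lookup-flipAt-≢ o x (j≢x ∘ sym ∘ toℕ-injective))
    (lookup-flipAt-≢ o y (j≢y ∘ sym ∘ toℕ-injective))

  view-move : ∀ o m → view o ⟶[ kindOf m ] view (move o m)
  view-move o nothing = stay
  view-move o (just j) with j ≟ x | j ≟ y
  ... | yes refl | _        = subst (view o ⟶[ alongX ]_) (sym (view-flipAt-x o)) flipX
  ... | no _     | yes refl = subst (view o ⟶[ alongY ]_) (sym (view-flipAt-y o)) flipY
  ... | no j≢x   | no j≢y   with lookup (outside o) j in oⱼ
  ...   | true  = subst₂ _⟶[ elsewhere ]_
                    (cong (λ r → ⟨ r , lookup o x , lookup o y ⟩) (sym (weight-flipAt-true (outside o) j oⱼ)))
                    (sym (view-flipAt-outside o j≢x j≢y)) down
  ...   | false = subst (view o ⟶[ elsewhere ]_)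
                    (sym (trans (view-flipAt-outside o j≢x j≢y)
                                (cong (λ r → ⟨ r , lookup o x , lookup o y ⟩) (weight-flipAt-false (outside o) j oⱼ))))
                    up

  view-pairStep : ∀ o pm →
    view (move o (pairStep pm)) ≡ ⟨ weight (outside o) , applyX pm (lookup o x) , applyY pm (lookup o y) ⟩
  view-pairStep o keep  = refl
  view-pairStep o moveX = view-flipAt-x o
  view-pairStep o moveY = view-flipAt-y o

  view-rule : ∀ o → view (move o (rule o)) ≡ respond watch (view o)
  view-rule o with find true (outside o)
  ... | inj₁ (j , oⱼ) = begin
    view (flipAt (toℕ j) o)                                             ≡⟨ view-flipAt-outside o j≢x j≢y ⟩
    ⟨ weight (flipAt (toℕ j) (outside o)) , lookup o x , lookup o y ⟩  ≡⟨ cong (λ r → respond watch ⟨ r , lookup o x , lookup o y ⟩) W≡1+W' ⟨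
    respond watch (view o)                                              ∎
    where
    open ≡-Reasoning
    W≡1+W' = weight-flipAt-true (outside o) j oⱼ
    j≢x : j ≢ x
    j≢x refl = not-¬ refl (trans (sym (lookup-outside-x o)) oⱼ)
    j≢y : j ≢ y
    j≢y refl = not-¬ refl (trans (sym (lookup-outside-y o)) oⱼ)
  ... | inj₂ clear = begin
    view (move o (pairStep pm))                                  ≡⟨ view-pairStep o pm ⟩
    ⟨ weight (outside o) , applyX pm (lookup o x) , applyY pm (lookup o y) ⟩
      ≡⟨ cong (λ r → ⟨ r , applyX pm (lookup o x) , applyY pm (lookup o y) ⟩) W≡0 ⟩
    respond watch ⟨ 0 , lookup o x , lookup o y ⟩
      ≡⟨ cong (λ r → respond watch ⟨ r , lookup o x , lookup o y ⟩) W≡0 ⟨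
    respond watch (view o)                                       ∎
    where
    open ≡-Reasoning
    pm = pairMove watch (lookup o x) (lookup o y)
    W≡0 = trans (cong weight clear) (weight-replicate k false)

  view-caught : ∀ o → view o ≡ caught → o ≡ replicate k false
  view-caught o eq = vec-ext coordinate
    where
    coordinate : ∀ j → lookup o j ≡ lookup (replicate k false) j
    coordinate j with j ≟ x | j ≟ y
    ... | yes refl | _        = trans (cong View.atX eq) (sym (lookup-replicate j false))
    ... | no _     | yes refl = trans (cong View.atY eq) (sym (lookup-replicate j false))
    ... | no j≢x   | no j≢y   = begin
      lookup o j                              ≡⟨ lookup-outside o j≢x j≢y ⟨
      lookup (outside o) j                    ≡⟨ cong (λ v → lookup v j) (weight≡0⇒≡replicate (outside o) (cong View.rest eq)) ⟩
      lookup (replicate k false) j            ∎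
      where open ≡-Reasoning

  chase : QV k → QV k → QV k
  chase v t = move v (rule (v ⊕ t))

  gap : QV k → QV k → ℕ
  gap v t = potential watch (view (v ⊕ t))

  view-chase : ∀ v t m → view (chase v (move t m) ⊕ move t m) ≡ respond watch (view (move (v ⊕ t) m))
  view-chase v t m = begin
    view (move v (rule (v ⊕ t')) ⊕ t')  ≡⟨ cong view (move-⊕ˡ v t' (rule (v ⊕ t'))) ⟩
    view (move (v ⊕ t') (rule (v ⊕ t')))  ≡⟨ view-rule (v ⊕ t') ⟩
    respond watch (view (v ⊕ t'))        ≡⟨ cong (respond watch ∘ view) (move-⊕ʳ v t m) ⟩
    respond watch (view (move (v ⊕ t) m)) ∎
    where
    open ≡-Reasoning
    t' = move t m

  chase-mono : ∀ v t m → gap (chase v (move t m)) (move t m) ≤ gap v t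
  chase-mono v t m = subst (_≤ gap v t) (sym (cong (potential watch) (view-chase v t m)))
                           (respond-mono (view-move (v ⊕ t) m))

  chase-progress : ∀ v t m → Watches watch (kindOf m) →
    chase v (move t m) ≡ move t m ⊎ gap (chase v (move t m)) (move t m) < gap v t
  chase-progress v t m watched with respond-progress watched (view-move (v ⊕ t) m)
  ... | inj₁ eq = inj₁ (⊕≡false⇒≡ _ _ (view-caught _ (trans (view-chase v t m) eq)))
  ... | inj₂ lt = inj₂ (subst (_< gap v t) (sym (cong (potential watch) (view-chase v t m))) lt)

  gap≤ : ∀ v t → gap v t ≤ 2 * k + 1
  gap≤ v t = ≤-trans (potential≤ watch (view (v ⊕ t))) (+-monoˡ-≤ 1 (*-monoʳ-≤ 2 (weight≤n (outside (v ⊕ t)))))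

-- Upper bound

sum-mono-≤ : ∀ {n} {f g : Fin n → ℕ} → (∀ i → f i ≤ g i) → sum f ≤ sum g
sum-mono-≤ {zero}  f≤g = z≤n
sum-mono-≤ {suc n} f≤g = +-mono-≤ (f≤g zero) (sum-mono-≤ (f≤g ∘ suc))

sum-mono-< : ∀ {n} {f g : Fin n → ℕ} → (∀ i → f i ≤ g i) → ∀ j → f j < g j → sum f < sum g
sum-mono-< {suc n} f≤g zero    fⱼ<gⱼ = +-mono-<-≤ fⱼ<gⱼ (sum-mono-≤ (f≤g ∘ suc))
sum-mono-< {suc n} f≤g (suc j) fⱼ<gⱼ = +-mono-≤-< (f≤g zero) (sum-mono-< (f≤g ∘ suc) j fⱼ<gⱼ)

sum≤ : ∀ {n} {f : Fin n → ℕ} {M} → (∀ i → f i ≤ M) → sum f ≤ n * M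
sum≤ {zero}  f≤M = z≤n
sum≤ {suc n} f≤M = +-mono-≤ (f≤M zero) (sum≤ (f≤M ∘ suc))

decreasing⇒eventually : ∀ {P : ℕ → Set} → Decidable P → (∀ t → P t → P (suc t)) →
             (μ : ℕ → ℕ) → (∀ t → ¬ P t → μ (suc t) < μ t) → ∀ t → μ 0 < t → P t
decreasing⇒eventually {P} P? stable μ decreasing t μ₀<t with reached t
  where
  reached : ∀ t → P t ⊎ μ t + t ≤ μ 0
  reached zero = inj₂ (≤-reflexive (+-identityʳ (μ 0)))
  reached (suc t) with P? t | reached t
  ... | yes Pt | _         = inj₁ (stable t Pt)
  ... | no _   | inj₁ Pt   = inj₁ (stable t Pt)
  ... | no ¬Pt | inj₂ μ+t≤ = inj₂ (begin
    μ (suc t) + suc t  ≡⟨ +-suc (μ (suc t)) t ⟩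
    suc (μ (suc t) + t) ≤⟨ +-monoˡ-≤ t (decreasing t ¬Pt) ⟩
    μ t + t            ≤⟨ μ+t≤ ⟩
    μ 0                ∎)
    where open ≤-Reasoning
... | inj₁ Pt   = Pt
... | inj₂ μ+t≤ = contradiction (≤-trans μ₀<t (≤-trans (m≤n+m t (μ t)) μ+t≤)) (<-irrefl refl)

transpose-cases : ∀ {n} (a b c : Fin n) →
  (c ≡ a × PC.transpose a b c ≡ b) ⊎
  (c ≢ a × c ≡ b × PC.transpose a b c ≡ a) ⊎
  (c ≢ a × c ≢ b × PC.transpose a b c ≡ c)
transpose-cases a b c with c ≟ a
... | yes c≡a = inj₁ (c≡a , refl)
... | no c≢a with c ≟ b
...   | yes c≡b = inj₂ (inj₁ (c≢a , c≡b , refl))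
...   | no c≢b  = inj₂ (inj₂ (c≢a , c≢b , refl))

k+⌊k/2⌋≡⌊3k/2⌋ : ∀ k → k + k / 2 ≡ (3 * k) / 2
k+⌊k/2⌋≡⌊3k/2⌋ k = sym (begin
  (3 * k) / 2            ≡⟨ cong (_/ 2) (trans (*-comm 3 k) (trans (*-suc k 2) (+-comm k (k * 2)))) ⟩
  (k * 2 + k) / 2        ≡⟨ +-distrib-/-∣ˡ {k * 2} k (divides k refl) ⟩
  k * 2 / 2 + k / 2      ≡⟨ cong (_+ k / 2) (m*n/n≡m k 2) ⟩
  k + k / 2              ∎)
  where open ≡-Reasoning

module UpperBound (m : ℕ) where
  k : ℕ
  k = suc (suc m)

  open Game (QV k) (QAdj k)
  open GameProperties (QV k) (QAdj k)

  h : ℕ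
  h = k / 2

  N : ℕ
  N = k + h

  1≤h : 1 ≤ h
  1≤h = m≥n⇒m/n>0 {k} {2} (s≤s (s≤s z≤n))

  h*2≡h+h : h * 2 ≡ h + h
  h*2≡h+h = trans (*-comm h 2) (cong (h +_) (+-identityʳ h))

  h+h≤k : h + h ≤ k
  h+h≤k = subst (_≤ k) h*2≡h+h (m/n*n≤m k 2)

  k≤1+h+h : k ≤ suc (h + h)
  k≤1+h+h = begin
    k                 ≡⟨ m≡m%n+[m/n]*n k 2 ⟩
    k % 2 + h * 2     ≤⟨ +-monoˡ-≤ (h * 2) (m<1+n⇒m≤n (m%n<n k 2)) ⟩
    1 + h * 2         ≡⟨ cong suc h*2≡h+h ⟩
    suc (h + h)       ∎
    where open ≤-Reasoning

  k≤N : k ≤ N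
  k≤N = m≤m+n k h

  stayGuard : Pursuer k
  stayGuard = record { x = fromℕ (suc m) ; y = zero ; x≢y = λ () ; watch = stillOrX }

  pairGuard : ∀ r → r < h → Pursuer k
  pairGuard r r<h = record
    { x     = fromℕ< (<-≤-trans r<h h≤k)
    ; y     = fromℕ< (≤-trans (+-monoˡ-≤ h r<h) h+h≤k)
    ; x≢y   = λ x≡y → <⇒≢ (m<m+n r 1≤h) (trans (sym (toℕ-fromℕ< _)) (trans (cong toℕ x≡y) (toℕ-fromℕ< _)))
    ; watch = pairFlips }
    where
    h≤k : h ≤ k
    h≤k = ≤-trans (m≤m+n h h) h+h≤k

  data Role : Set where
    glued   : ℕ → Role
    chasing : Pursuer k → Role
    idle    : Role

  data IsChasing : Role → Set where
    chases : ∀ c → IsChasing (chasing c)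

  isChasing? : Decidable IsChasing
  isChasing? (glued _)   = no λ ()
  isChasing? (chasing c) = yes (chases c)
  isChasing? idle        = no λ ()

  chaserAt : ℕ → Role
  chaserAt zero    = chasing stayGuard
  chaserAt (suc r) with r <? h
  ... | yes r<h = chasing (pairGuard r r<h)
  ... | no _    = idle

  roleAt : ℕ → ℕ → Role
  roleAt i s with s <? i | i <? k
  ... | yes _ | _     = glued s
  ... | no _  | yes _ = chaserAt (s ∸ i)
  ... | no _  | no _  = idle

  record State : Set where
    field
      stage : ℕ
      slot  : Permutation′ N
      pos   : Config N

    slotOf : Fin N → ℕ
    slotOf g = toℕ (slot ⟨$⟩ʳ g)

    roleOf : Fin N → Role
    roleOf g = roleAt stage (slotOf g)
  open State

  moveRole : Role → QV k → QV k → ℕ → QV k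
  moveRole (glued c)   v p i = flipAt c p
  moveRole (chasing c) v p i = Pursuit.chase c v (flipAt i p)
  moveRole idle        v p i = v

  next : State → QV k → Config N
  next st p g = moveRole (roleOf st g) (pos st g) p (stage st)

  Catches : State → QV k → Fin N → Set
  Catches st p g = IsChasing (roleOf st g) × next st p g ≡ flipAt (stage st) p

  catches? : ∀ st p → Decidable (Catches st p)
  catches? st p g = isChasing? (roleOf st g) ×-dec ≡-dec _≟ᵇ_ (next st p g) (flipAt (stage st) p)

  chasing⇒stage<k : ∀ {i s} → IsChasing (roleAt i s) → i ≤ s × i < k
  chasing⇒stage<k {i} {s} isCh with s <? i | i <? k | isCh
  ... | yes _   | _       | ()
  ... | no s≮i  | yes i<k | _  = ≮⇒≥ s≮i , i<k
  ... | no _    | no _    | ()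

  stageSlot : ∀ {i} → i < k → Fin N
  stageSlot i<k = fromℕ< (<-≤-trans i<k k≤N)

  -- The chaser that caught the neighbour in direction `stage` trades slots with
  -- slot `stage`, which thereby becomes a placed bodyguard.
  advance : ∀ st p → ∃ (Catches st p) → State
  advance st p (g , isCh , _) = record
    { stage = suc (stage st)
    ; slot  = slot st ∘ₚ transpose (slot st ⟨$⟩ʳ g) (stageSlot (proj₂ (chasing⇒stage<k {stage st} {slotOf st g} isCh)))
    ; pos   = next st p }

  update : State → QV k → State
  update st p with any? (catches? st p)
  ... | yes catch = advance st p catch
  ... | no _      = record st { pos = next st p }

  chaserAt≢glued : ∀ r {c} → chaserAt r ≢ glued c
  chaserAt≢glued zero    ()
  chaserAt≢glued (suc r) eq with r <? h
  chaserAt≢glued (suc r) () | yes _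
  chaserAt≢glued (suc r) () | no _

  roleAt-< : ∀ {i s} → s < i → roleAt i s ≡ glued s
  roleAt-< {i} {s} s<i with s <? i
  ... | yes _   = refl
  ... | no s≮i  = contradiction s<i s≮i

  roleAt-glued : ∀ {i s c} → roleAt i s ≡ glued c → s < i × s ≡ c
  roleAt-glued {i} {s} eq with s <? i | i <? k | eq
  ... | yes s<i | _     | refl = s<i , refl
  ... | no _    | yes _ | eq′  = contradiction eq′ (chaserAt≢glued (s ∸ i))
  ... | no _    | no _  | ()

  roleAt-+ : ∀ {i} r → i < k → roleAt i (i + r) ≡ chaserAt r
  roleAt-+ {i} r i<k with i + r <? i | i <? k
  ... | yes i+r<i | _       = contradiction i+r<i (≤⇒≯ (m≤m+n i r))
  ... | no _      | yes _   = cong chaserAt (m+n∸m≡n i r)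
  ... | no _      | no i≮k  = contradiction i<k i≮k

  record Invariant (st : State) (p : QV k) : Set where
    field
      stage≤k  : stage st ≤ k
      glued-on : ∀ g → slotOf st g < stage st → pos st g ≡ flipAt (slotOf st g) p
  open Invariant

  initial : State
  initial = record { stage = 0 ; slot = Permutation.id ; pos = λ _ → replicate k false }

  invariant-initial : ∀ p → Invariant initial p
  invariant-initial p = record { stage≤k = z≤n ; glued-on = λ _ () }

  pos-update : ∀ st p → pos (update st p) ≡ next st p
  pos-update st p with any? (catches? st p)
  ... | yes _ = refl
  ... | no _  = refl

  moveRole-legal : ∀ r v {p p'} i → (∀ c → r ≡ glued c → v ≡ flipAt c p) → Step p p' →
                   Step v (moveRole r v p' i)
  moveRole-legal (glued c)   v i onNeighbour p~p' =
    subst (λ u → Step u (flipAt c _)) (sym (onNeighbour c refl)) (flipAt-step c p~p')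
  moveRole-legal (chasing c) v {p' = p'} i _ _ = move-step v (Pursuit.rule c (v ⊕ flipAt i p'))
  moveRole-legal idle        v i _ _ = inj₁ refl

  update-legal : ∀ {st p p'} → Invariant st p → Step p p' → BStep (pos st) (pos (update st p'))
  update-legal {st} {p} {p'} I p~p' g rewrite pos-update st p' =
    moveRole-legal (roleOf st g) (pos st g) (stage st) onNeighbour p~p'
    where
    onNeighbour : ∀ c → roleOf st g ≡ glued c → pos st g ≡ flipAt c p
    onNeighbour c eq with roleAt-glued {stage st} {slotOf st g} eq
    ... | s<i , refl = glued-on I g s<i

  slot-injective : ∀ {st g g'} → slot st ⟨$⟩ʳ g ≡ slot st ⟨$⟩ʳ g' → g ≡ g'
  slot-injective {st} {g} {g'} eq =
    trans (sym (inverseˡ (slot st))) (trans (cong (slot st ⟨$⟩ˡ_) eq) (inverseˡ (slot st)))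

  invariant-update : ∀ {st p} p' → Invariant st p → Invariant (update st p') p'
  invariant-update {st} p' I with any? (catches? st p')
  ... | no _ = record
    { stage≤k  = stage≤k I
    ; glued-on = λ g s<i → cong (λ r → moveRole r (pos st g) p' (stage st)) (roleAt-< s<i) }
  ... | yes (g* , isCh , caught) = record { stage≤k = i<k ; glued-on = glued-on′ }
    where
    i = stage st
    a = slot st ⟨$⟩ʳ g*
    i≤a = proj₁ (chasing⇒stage<k {i} {toℕ a} isCh)
    i<k = proj₂ (chasing⇒stage<k {i} {toℕ a} isCh)
    b = stageSlot i<k
    toℕb≡i : toℕ b ≡ i
    toℕb≡i = toℕ-fromℕ< _
    glued-on′ : ∀ g → toℕ (PC.transpose a b (slot st ⟨$⟩ʳ g)) < suc i →
                next st p' g ≡ flipAt (toℕ (PC.transpose a b (slot st ⟨$⟩ʳ g))) p'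
    glued-on′ g lt with transpose-cases a b (slot st ⟨$⟩ʳ g)
    ... | inj₁ (sg≡a , τ≡b) with slot-injective {st} {g} {g*} sg≡a
    ...   | refl = trans caught (cong (λ j → flipAt j p') (sym (trans (cong toℕ τ≡b) toℕb≡i)))
    glued-on′ g lt | inj₂ (inj₁ (sg≢a , sg≡b , τ≡a)) =
      contradiction a≡b (λ a≡b → sg≢a (trans sg≡b (sym a≡b)))
      where
      a≡b : a ≡ b
      a≡b = toℕ-injective (trans (≤-antisym (m<1+n⇒m≤n (subst (λ c → toℕ c < suc i) τ≡a lt)) i≤a)
                                 (sym toℕb≡i))
    glued-on′ g lt | inj₂ (inj₂ (sg≢a , sg≢b , τ≡sg)) =
      trans (cong (λ r → moveRole r (pos st g) p' i) (roleAt-< s<i))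
            (cong (λ c → flipAt (toℕ c) p') (sym τ≡sg))
      where
      s<i : slotOf st g < i
      s<i = ≤∧≢⇒< (m<1+n⇒m≤n (subst (λ c → toℕ c < suc i) τ≡sg lt))
                  (sg≢b ∘ toℕ-injective ∘ flip trans (sym toℕb≡i))

  surrounded : ∀ {st p} → Invariant st p → stage st ≡ k → Surrounded (pos st) p
  surrounded {st} {p} I done w p~w = g , (begin
    pos st g                        ≡⟨ glued-on I g (subst (_< stage st) (sym slotOf-g) (subst (toℕ j <_) (sym done) (toℕ<n j))) ⟩
    flipAt (slotOf st g) p          ≡⟨ cong (λ s → flipAt s p) slotOf-g ⟩
    flipAt (toℕ j) p                ≡⟨ QAdj⇒flipAt {u = p} {v = w} p~w ⟨
    w                               ∎)
    where
    open ≡-Reasoning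
    j = proj₁ p~w
    g = slot st ⟨$⟩ˡ inject≤ j k≤N
    slotOf-g : slotOf st g ≡ toℕ j
    slotOf-g = trans (cong toℕ (inverseʳ (slot st))) (toℕ-inject≤ j k≤N)

  stage-update : ∀ {st} p → stage st ≡ k → stage (update st p) ≡ k
  stage-update {st} p done with any? (catches? st p)
  ... | yes (g , isCh , _) = contradiction (proj₂ (chasing⇒stage<k {stage st} {slotOf st g} isCh)) (<-irrefl done)
  ... | no _               = done

  gapOf : Role → QV k → QV k → ℕ → ℕ
  gapOf (chasing c) v p i = Pursuit.gap c v (flipAt i p)
  gapOf _           _ _ _ = 0

  gapBound : ℕ
  gapBound = 2 * k + 1

  gapOf≤ : ∀ r v p i → gapOf r v p i ≤ gapBound
  gapOf≤ (glued _)   v p i = z≤n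
  gapOf≤ (chasing c) v p i = Pursuit.gap≤ c v (flipAt i p)
  gapOf≤ idle        v p i = z≤n

  totalGap : State → QV k → ℕ
  totalGap st p = sum λ g → gapOf (roleOf st g) (pos st g) p (stage st)

  -- Completing a direction outweighs any increase of totalGap (totalGap≤).
  measure : State → QV k → ℕ
  measure st p = (k ∸ stage st) * suc (N * gapBound) + totalGap st p

  gapOf-mono : ∀ r v p μ i → gapOf r (moveRole r v (move p μ) i) (move p μ) i ≤ gapOf r v p i
  gapOf-mono (glued _)   v p μ i = z≤n
  gapOf-mono (chasing c) v p μ i rewrite flipAt-move i p μ = Pursuit.chase-mono c v (flipAt i p) μ
  gapOf-mono idle        v p μ i = z≤n

  chasing-progress : ∀ c v p μ i → Watches (Pursuer.watch c) (Pursuit.kindOf c μ) →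
    let r = chasing c ; v' = moveRole r v (move p μ) i in
    v' ≡ flipAt i (move p μ) ⊎ gapOf r v' (move p μ) i < gapOf r v p i
  chasing-progress c v p μ i watched rewrite flipAt-move i p μ = Pursuit.chase-progress c v (flipAt i p) μ watched

  chaserAt-suc : ∀ {r} (r<h : r < h) → chaserAt (suc r) ≡ chasing (pairGuard r r<h)
  chaserAt-suc {r} r<h with r <? h
  ... | yes r<h′ = cong (chasing ∘ pairGuard r) (<-irrelevant r<h′ r<h)
  ... | no r≮h   = contradiction r<h r≮h

  -- Coordinate k - 1 is watched by stayGuard; every other coordinate is r or
  -- r + h for some r < h, as k ≤ 1 + h + h.
  watchingChaser : ∀ μ → ∃[ r ] r ≤ h × ∃[ c ] chaserAt r ≡ chasing c × Watches (Pursuer.watch c) (Pursuit.kindOf c μ)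
  watchingChaser nothing = 0 , z≤n , stayGuard , refl , still-still
  watchingChaser (just j) with toℕ j ℕ≟ suc m
  ... | yes j≡last = 0 , z≤n , stayGuard , refl ,
    subst (Watches stillOrX) (sym (Pursuit.kindOf-x stayGuard (toℕ-injective (trans j≡last (sym (toℕ-fromℕ (suc m))))))) still-x
  ... | no j≢last with toℕ j <? h
  ...   | yes j<h = suc (toℕ j) , j<h , pairGuard (toℕ j) j<h , chaserAt-suc j<h ,
    subst (Watches pairFlips) (sym (Pursuit.kindOf-x (pairGuard (toℕ j) j<h) (toℕ-injective (sym (toℕ-fromℕ< _))))) pair-x
  ...   | no j≮h = suc r , r<h , pairGuard r r<h , chaserAt-suc r<h ,
    subst (Watches pairFlips) (sym (Pursuit.kindOf-y (pairGuard r r<h) j≡y)) pair-y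
    where
    h≤j : h ≤ toℕ j
    h≤j = ≮⇒≥ j≮h
    r = toℕ j ∸ h
    j<h+h : toℕ j < h + h
    j<h+h = ≤-trans (≤∧≢⇒< (m<1+n⇒m≤n (toℕ<n j)) j≢last) (m<1+n⇒m≤n k≤1+h+h)
    r<h : r < h
    r<h = +-cancelʳ-< h r h (subst (_< h + h) (sym (m∸n+n≡m h≤j)) j<h+h)
    j≡y : j ≡ Pursuer.y (pairGuard r r<h)
    j≡y = toℕ-injective (trans (sym (m∸n+n≡m h≤j)) (sym (toℕ-fromℕ< _)))

  watchingGuard : ∀ st → stage st < k → ∀ μ →
    ∃[ g ] ∃[ c ] roleOf st g ≡ chasing c × Watches (Pursuer.watch c) (Pursuit.kindOf c μ)
  watchingGuard st i<k μ with watchingChaser μ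
  ... | r , r≤h , c , chaserAt-r , watched = g , c , trans roleOf-g chaserAt-r , watched
    where
    g = slot st ⟨$⟩ˡ fromℕ< (+-mono-<-≤ i<k r≤h)
    roleOf-g : roleOf st g ≡ chaserAt r
    roleOf-g = trans (cong (roleAt (stage st)) (trans (cong toℕ (inverseʳ (slot st))) (toℕ-fromℕ< _)))
                     (roleAt-+ r i<k)

  totalGap≤ : ∀ st p → totalGap st p ≤ N * gapBound
  totalGap≤ st p = sum≤ λ g → gapOf≤ (roleOf st g) (pos st g) p (stage st)

  measure-advance : ∀ st st′ p p′ → stage st′ ≡ suc (stage st) → stage st < k → measure st′ p′ < measure st p
  measure-advance st st′ p p′ advanced i<k = begin-strict
    measure st′ p′                     ≡⟨ cong (λ s → (k ∸ s) * B + totalGap st′ p′) advanced ⟩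
    (k ∸ suc i) * B + totalGap st′ p′  ≤⟨ +-monoʳ-≤ ((k ∸ suc i) * B) (totalGap≤ st′ p′) ⟩
    (k ∸ suc i) * B + N * gapBound    <⟨ +-monoʳ-< ((k ∸ suc i) * B) (n<1+n (N * gapBound)) ⟩
    (k ∸ suc i) * B + B               ≡⟨ +-comm ((k ∸ suc i) * B) B ⟩
    suc (k ∸ suc i) * B               ≡⟨ cong (_* B) (+-∸-assoc 1 i<k) ⟨
    (k ∸ i) * B                       ≤⟨ m≤m+n ((k ∸ i) * B) (totalGap st p) ⟩
    measure st p                      ∎
    where
    open ≤-Reasoning
    i = stage st
    B = suc (N * gapBound)

  measure-update : ∀ {st p} μ → stage st < k → measure (update st (move p μ)) (move p μ) < measure st p
  measure-update {st} {p} μ i<k with any? (catches? st (move p μ))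
  ... | yes catch = measure-advance st (advance st (move p μ) catch) p (move p μ) refl i<k
  ... | no noCatch = +-monoʳ-< ((k ∸ stage st) * suc (N * gapBound))
                       (sum-mono-< (λ g → gapOf-mono (roleOf st g) (pos st g) p μ (stage st)) g strict)
    where
    i = stage st
    W = watchingGuard st i<k μ
    g = proj₁ W
    c = proj₁ (proj₂ W)
    role-g = proj₁ (proj₂ (proj₂ W))
    P : Role → Set
    P r = let v' = moveRole r (pos st g) (move p μ) i in
          v' ≡ flipAt i (move p μ) ⊎ gapOf r v' (move p μ) i < gapOf r (pos st g) p i
    strict : gapOf (roleOf st g) (next st (move p μ) g) (move p μ) i < gapOf (roleOf st g) (pos st g) p i
    strict with subst P (sym role-g) (chasing-progress c (pos st g) p μ i (proj₂ (proj₂ (proj₂ W))))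
    ... | inj₁ caught = contradiction (g , subst IsChasing (sym role-g) (chases c) , caught) noCatch
    ... | inj₂ lt     = lt

  strategy : BStrategy N
  strategy H = pos (List.foldl update initial H)

  module _ (p : ℕ → QV k) (valid : ValidPresident p) where
    -- Folded from the history, like strategy itself, so that
    -- play strategy p (suc t) is pos (stateAfter t) by definition.
    stateAfter : ℕ → State
    stateAfter t = List.foldl update initial (history p t)

    stateAfter-suc : ∀ t → stateAfter (suc t) ≡ update (stateAfter t) (p (suc t))
    stateAfter-suc t = trans (cong (List.foldl update initial) (history-suc p t))
                             (foldl-∷ʳ update initial (p (suc t)) (history p t))

    invariant : ∀ t → Invariant (stateAfter t) (p t)
    invariant zero    = invariant-update (p 0) (invariant-initial (p 0))
    invariant (suc t) = subst (λ st → Invariant st (p (suc t))) (sym (stateAfter-suc t))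
                              (invariant-update (p (suc t)) (invariant t))

    legal : ∀ t → BStep (play strategy p t) (play strategy p (suc t))
    legal zero    = update-legal (invariant-initial (p 0)) (inj₁ refl)
    legal (suc t) = subst (λ st → BStep (pos (stateAfter t)) (pos st)) (sym (stateAfter-suc t))
                          (update-legal (invariant t) (valid t))

    measure-decreasing : ∀ t → stage (stateAfter t) ≢ k →
                         measure (stateAfter (suc t)) (p (suc t)) < measure (stateAfter t) (p t)
    measure-decreasing t unfinished =
      subst (λ st → measure st (p (suc t)) < measure (stateAfter t) (p t)) (sym (stateAfter-suc t))
        (subst (λ q → measure (update (stateAfter t) q) q < measure (stateAfter t) (p t)) (sym p′≡)
          (measure-update {stateAfter t} {p t} μ (≤∧≢⇒< (stage≤k (invariant t)) unfinished)))
      where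
      μ = proj₁ (step⇒move (valid t))
      p′≡ = proj₂ (step⇒move (valid t))

    finished : ∀ t → measure (stateAfter 0) (p 0) < t → stage (stateAfter t) ≡ k
    finished = decreasing⇒eventually (λ t → stage (stateAfter t) ℕ≟ k)
                          (λ t done → trans (cong stage (stateAfter-suc t)) (stage-update (p (suc t)) done))
                          (λ t → measure (stateAfter t) (p t)) measure-decreasing

    strategy-wins : (∀ t → BStep (play strategy p t) (play strategy p (suc t)))
                  × (∃[ T ] (∀ t → T ≤ t → Surrounded (play strategy p (suc t)) (p t)))
    strategy-wins =
      legal , suc (measure (stateAfter 0) (p 0)) , λ t T≤t → surrounded (invariant t) (finished t T≤t)

  strategy-winning : Winning strategy
  strategy-winning = strategy-wins

upper-bound : ∀ k → 2 ≤ k → Game.B≤ (QV k) (QAdj k) ((3 * k) / 2)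
upper-bound (suc (suc m)) _ = N , ≤-reflexive (k+⌊k/2⌋≡⌊3k/2⌋ k) , strategy , strategy-winning
  where open UpperBound m
upper-bound (suc zero) (s≤s ())

theorem4p8 : (k : ℕ) → 3 ≤ k →
    Game.B≥ (QV k) (QAdj k) (k + 1) × Game.B≤ (QV k) (QAdj k) ((3 * k) / 2)
theorem4p8 k 3≤k = lower-bound k 3≤k , upper-bound k (≤-trans (n≤1+n 2) 3≤k)
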